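{- Fix an integer $k\geq 2$. Let $F$ be a connected split graph and let $(K,S)$ be a $K$-max $KS$-partition of $V(F)$. Then $F$ is a $\mathsf{TS}_k$-reconfiguration graph if and only if $|N_F(v)\cap S|\leq k-1$ for every $v\in K$ and $|N_F(w)|=1$ for every $w\in S$.
   Context: All graphs are finite, simple and undirected. $N_F(v)$ denotes the set of neighbours of $v$ in $F$. A graph $F$ is a split graph if $V(F)$ can be partitioned into sets $K$ and $S$ (a $KS$-partition) such that $K$ is a clique and $S$ is an independent set of $F$; a $KS$-partition is $K$-max if $|K|=\omega(F)$, the maximum size of a clique of $F$. An independent set of a graph is a set of pairwise non-adjacent vertices. For a positive integer $k$, $\mathsf{TS}_k(G)$ is the graph whose vertices are the independent sets of $G$ of size exactly $k$, where two such sets $I,J$ are adjacent iff there exist $u,v\in V(G)$ with $I\setminus J=\{u\}$, $J\setminus I=\{v\}$ and $uv\in E(G)$. A graph $F$ is a $\mathsf{TS}_k$-reconfiguration graph if there exists a graph $G$ with $F\simeq \mathsf{TS}_k(G)$. -}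

module Defs where

open import Data.Nat using (ℕ; _≤_; _∸_)
open import Data.Bool using (Bool; true; false)
open import Data.Fin using (Fin)
open import Data.Fin.Subset using (Subset; _∈_; _∉_; ∁; _∩_; _─_; ⁅_⁆; ∣_∣)
open import Data.Vec using (tabulate)
open import Data.Product using (Σ; ∃; _×_)
open import Relation.Binary.PropositionalEquality using (_≡_; _≢_)

record Graph : Set where
  field
    n     : ℕ
    adj   : Fin n → Fin n → Bool
    sym   : ∀ u v → adj u v ≡ adj v u
    irrefl : ∀ u → adj u u ≡ false
open Graph public

Edge : (G : Graph) → Fin (n G) → Fin (n G) → Set
Edge G u v = adj G u v ≡ true

Nbhd : (G : Graph) → Fin (n G) → Subset (n G)
Nbhd G v = tabulate (adj G v)

IsIndependent : (G : Graph) → Subset (n G) → Set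
IsIndependent G I = ∀ u v → u ∈ I → v ∈ I → adj G u v ≡ false

IsClique : (G : Graph) → Subset (n G) → Set
IsClique G C = ∀ u v → u ∈ C → v ∈ C → u ≢ v → Edge G u v

data Reach (G : Graph) : Fin (n G) → Fin (n G) → Set where
  here : ∀ {u} → Reach G u u
  step : ∀ {u w v} → Edge G u w → Reach G w v → Reach G u v

Connected : Graph → Set
Connected G = ∀ u v → Reach G u v

IsKSPartition : (F : Graph) → Subset (n F) → Set
IsKSPartition F K = IsClique F K × IsIndependent F (∁ K)

-- K-max: moreover |K| = ω(F), i.e. every clique has size ≤ |K|
IsKMaxKSPartition : (F : Graph) → Subset (n F) → Set
IsKMaxKSPartition F K =
  IsKSPartition F K × (∀ C → IsClique F C → ∣ C ∣ ≤ ∣ K ∣)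

IsTSVertex : ℕ → (G : Graph) → Subset (n G) → Set
IsTSVertex k G I = IsIndependent G I × ∣ I ∣ ≡ k

TSAdj : (G : Graph) → Subset (n G) → Subset (n G) → Set
TSAdj G I J = Σ (Fin (n G)) λ u → Σ (Fin (n G)) λ v →
  (I ─ J ≡ ⁅ u ⁆) × (J ─ I ≡ ⁅ v ⁆) × Edge G u v

IsoToTS : ℕ → (F G : Graph) → Set
IsoToTS k F G = Σ (Fin (n F) → Subset (n G)) λ f →
  (∀ x → IsTSVertex k G (f x)) ×
  (∀ x y → f x ≡ f y → x ≡ y) ×
  (∀ J → IsTSVertex k G J → ∃ λ x → f x ≡ J) ×
  (∀ x y → Edge F x y → TSAdj G (f x) (f y)) ×
  (∀ x y → TSAdj G (f x) (f y) → Edge F x y)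

IsTSReconfigurationGraph : ℕ → Graph → Set
IsTSReconfigurationGraph k F = ∃ λ G → IsoToTS k F G

module Submission where

-- Suppose f : F ≃ TS_k(G), and call the vertex of f v that the step f v → f t removes the removal of the
-- edge vt.  In a triangle v, a, b the edges va and vb have the same removal.  Two nonadjacent neighbours
-- t₁, t₂ of v₀ ∈ K never do: if both remove u, let x₂ be the vertex added by f v₀ → f t₂ and u' ≠ u a
-- second element of f v₀ (k ≥ 2); then (f t₁ − u') + x₂ is an independent k-set two exchanges away from
-- f v₀, whose preimage can be neither adjacent to v₀ nor, by connectivity, joined to it through a common
-- K-neighbour.  Maximality of K gives each w ∈ S a non-neighbour in K, whence w has a single neighbour,
-- and the S-neighbours of v ∈ K plus one further K-vertex have distinct removals in f v: at most k.
-- Conversely, let G consist of V(F), complete except that each w ∈ S misses its parent (its unique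
-- neighbour), and k − 1 independent label vertices, w ∈ S being joined only to its own label; siblings get
-- distinct labels, which the degree bound allows.  Then t ↦ {t} ∪ labels for t ∈ K and
-- w ↦ {w, parent w} ∪ labels − label w for w ∈ S is an isomorphism F ≃ TS_k(G).

open import Defs renaming (sym to adj-sym)
open import Data.Bool using (Bool; true; false; _∧_; _∨_; not) renaming (_≟_ to _≟ᵇ_)
open import Data.Bool.Properties
  using (∧-zeroʳ; ∧-identityʳ; ∨-zeroʳ; ∨-identityʳ; ∧-conicalˡ; ∧-conicalʳ; not-injective; ¬-not; T-≡)
open import Data.Empty using (⊥; ⊥-elim)
open import Data.Fin using (Fin; zero; suc; toℕ; _↑ˡ_; _↑ʳ_; splitAt; join)
open import Data.Fin.Properties using (_≟_; any?; all?; ¬∀⟶∃¬; splitAt-↑ˡ; splitAt-↑ʳ; join-splitAt; ↑ˡ-injective)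
import Data.Fin.Properties as Fin
open import Data.Fin.Subset using (Subset; _∈_; ∁; _∩_; _∪_; _─_; ⁅_⁆; ∣_∣)
open import Data.Fin.Subset.Properties using (x∈⁅x⁆; x∈⁅y⁆⇒x≡y; x∈p∪q⁻; ∣⁅x⁆∣≡1)
open import Data.Nat using (ℕ; zero; suc; _+_; _≤_; _<_; _<ᵇ_; z≤n; s≤s; _∸_)
open import Data.Nat.DivMod using (_mod_; m<n⇒m%n≡m)
open import Data.Nat.Properties using (≤-refl; ≤-trans; ≤-reflexive; +-suc; +-assoc; m≤n⇒m≤1+n; <⇒≱)
import Data.Nat.Properties as ℕ
open import Data.Product using (∃; ∃-syntax; _×_; _,_; proj₁; proj₂)
open import Data.Sum using (_⊎_; inj₁; inj₂)
open import Data.Vec using ([]; _∷_; lookup; tabulate)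
open import Data.Vec.Properties
  using ([]=⇒lookup; lookup⇒[]=; lookup-map; lookup-zipWith; lookup∘tabulate; tabulate∘lookup; tabulate-cong)
open import Function using (_∘_; flip)
open import Function.Bundles using (_⇔_; mk⇔; Equivalence)
open import Relation.Binary using (tri<; tri≈; tri>)
open import Relation.Nullary using (¬_; ¬?; Dec; yes; no; does)
open import Relation.Nullary.Decidable using (_×-dec_; _→-dec_)
open import Relation.Binary.PropositionalEquality
  using (_≡_; _≢_; refl; sym; trans; cong; cong₂; subst; subst₂; module ≡-Reasoning)

-- Counting

_==_ : ∀ {n} → Fin n → Fin n → Bool
i == j = does (i ≟ j)

==-refl : ∀ {n} (i : Fin n) → (i == i) ≡ true
==-refl i with i ≟ i
... | yes _ = refl
... | no i≢i = ⊥-elim (i≢i refl)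

==-≢ : ∀ {n} {i j : Fin n} → i ≢ j → (i == j) ≡ false
==-≢ {i = i} {j} i≢j with i ≟ j
... | yes i≡j = ⊥-elim (i≢j i≡j)
... | no _ = refl

==⇒≡ : ∀ {n} {i j : Fin n} → (i == j) ≡ true → i ≡ j
==⇒≡ {i = i} {j} eq with i ≟ j
... | yes i≡j = i≡j

==-sym : ∀ {n} (i j : Fin n) → (i == j) ≡ (j == i)
==-sym i j with i ≟ j | j ≟ i
... | yes _ | yes _ = refl
... | no _ | no _ = refl
... | yes i≡j | no j≢i = ⊥-elim (j≢i (sym i≡j))
... | no i≢j | yes j≡i = ⊥-elim (i≢j (sym j≡i))

∨-==-self : ∀ {n} (h : Fin n → Bool) (w : Fin n) → (h w ∨ (w == w)) ≡ true
∨-==-self h w rewrite ==-refl w = ∨-zeroʳ (h w)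

∨-==-other : ∀ {n} (h : Fin n → Bool) {w e : Fin n} → e ≢ w → (h e ∨ (e == w)) ≡ h e
∨-==-other h {e = e} e≢w rewrite ==-≢ e≢w = ∨-identityʳ (h e)

∨-==-cases : ∀ {n} (h : Fin n → Bool) {w e : Fin n} → (h e ∨ (e == w)) ≡ true → h e ≡ true ⊎ e ≡ w
∨-==-cases h {e = e} he∨ with h e
... | true = inj₁ refl
... | false = inj₂ (==⇒≡ he∨)

toℕᵇ : Bool → ℕ
toℕᵇ true = 1
toℕᵇ false = 0

count : ∀ {n} → (Fin n → Bool) → ℕ
count {zero} h = 0
count {suc n} h = toℕᵇ (h zero) + count (h ∘ suc)

_⊆ᵇ_ : ∀ {n} → (Fin n → Bool) → (Fin n → Bool) → Set
h ⊆ᵇ h' = ∀ i → h i ≡ true → h' i ≡ true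

count-cong : ∀ {n} {h h' : Fin n → Bool} → (∀ i → h i ≡ h' i) → count h ≡ count h'
count-cong {zero} eq = refl
count-cong {suc n} eq = cong₂ _+_ (cong toℕᵇ (eq zero)) (count-cong (eq ∘ suc))

count-mono : ∀ {n} {h h' : Fin n → Bool} → h ⊆ᵇ h' → count h ≤ count h'
count-mono {zero} h⊆h' = z≤n
count-mono {suc n} {h} {h'} h⊆h' with h zero in h0 | h' zero in h'0
... | true | true = s≤s (count-mono (h⊆h' ∘ suc))
... | false | true = m≤n⇒m≤1+n (count-mono (h⊆h' ∘ suc))
... | false | false = count-mono (h⊆h' ∘ suc)
... | true | false with trans (sym h'0) (h⊆h' zero h0)
... | ()

count-insert : ∀ {n} {h h' : Fin n → Bool} (s : Fin n) → h s ≡ false → h' s ≡ true →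
  (∀ i → i ≢ s → h i ≡ h' i) → count h' ≡ suc (count h)
count-insert {h = h} {h'} zero hs h's agree rewrite hs | h's =
  cong suc (count-cong (λ i → sym (agree (suc i) λ ())))
count-insert {h = h} {h'} (suc s) hs h's agree rewrite agree zero (λ ()) =
  trans (cong (toℕᵇ (h' zero) +_) (count-insert s hs h's (λ i i≢s → agree (suc i) (i≢s ∘ Fin.suc-injective))))
        (+-suc (toℕᵇ (h' zero)) _)

count-remove : ∀ {n} (h : Fin n → Bool) {s : Fin n} → h s ≡ true →
  count h ≡ suc (count (λ i → h i ∧ not (i == s)))
count-remove h {s} hs = count-insert s removed hs agree
  where
  removed : (h s ∧ not (s == s)) ≡ false
  removed rewrite ==-refl s = ∧-zeroʳ (h s)
  agree : ∀ i → i ≢ s → (h i ∧ not (i == s)) ≡ h i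
  agree i i≢s rewrite ==-≢ i≢s = ∧-identityʳ (h i)

count-⊆-antisym : ∀ {n} {h h' : Fin n → Bool} → h ⊆ᵇ h' → count h' ≤ count h → h' ⊆ᵇ h
count-⊆-antisym {h = h} {h'} h⊆h' h'≤h i h'i with h i in hi
... | true = refl
... | false = ⊥-elim (<⇒≱ (subst (_≤ count h') (count-insert i hi i∈h+i agree) (count-mono h+i⊆h')) h'≤h)
  where
  h+i : Fin _ → Bool
  h+i j = h j ∨ (j == i)
  i∈h+i : h+i i ≡ true
  i∈h+i rewrite ==-refl i = ∨-zeroʳ (h i)
  agree : ∀ j → j ≢ i → h j ≡ h+i j
  agree j j≢i rewrite ==-≢ j≢i = sym (∨-identityʳ (h j))
  h+i⊆h' : h+i ⊆ᵇ h'
  h+i⊆h' j hj with h j in eq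
  ... | true = h⊆h' j eq
  ... | false = subst (λ j → h' j ≡ true) (sym (==⇒≡ hj)) h'i

count-witness : ∀ {n} (h : Fin n → Bool) → 0 < count h → ∃[ i ] h i ≡ true
count-witness {suc n} h pos with h zero in h0
... | true = zero , h0
... | false with count-witness (h ∘ suc) pos
... | i , hi = suc i , hi

count-false : ∀ {n} (h : Fin n → Bool) → (∀ i → h i ≡ false) → count h ≡ 0
count-false {zero} h none = refl
count-false {suc n} h none rewrite none zero = count-false (h ∘ suc) (none ∘ suc)

count-true : ∀ n → count {n} (λ _ → true) ≡ n
count-true zero = refl
count-true (suc n) = cong suc (count-true n)

count-singleton : ∀ {n} (j : Fin n) → count (_== j) ≡ 1
count-singleton {n} j =
  trans (count-insert j refl (==-refl j) (λ i i≢j → sym (==-≢ i≢j)))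
        (cong suc (count-false {n} (λ _ → false) (λ _ → refl)))

count-pair : ∀ {n} {i j : Fin n} → i ≢ j → count (λ e → (e == i) ∨ (e == j)) ≡ 2
count-pair {i = i} {j} i≢j =
  trans (count-insert j (==-≢ (i≢j ∘ sym)) j∈ agree) (cong suc (count-singleton i))
  where
  j∈ : ((j == i) ∨ (j == j)) ≡ true
  j∈ rewrite ==-refl j = ∨-zeroʳ (j == i)
  agree : ∀ e → e ≢ j → (e == i) ≡ ((e == i) ∨ (e == j))
  agree e e≢j rewrite ==-≢ e≢j = sym (∨-identityʳ (e == i))

count≥2⇒another : ∀ {n} (h : Fin n → Bool) → 2 ≤ count h → (u : Fin n) → ∃[ i ] h i ≡ true × i ≢ u
count≥2⇒another h two u with any? (λ i → (h i ≟ᵇ true) ×-dec ¬? (i ≟ u))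
... | yes other = other
... | no none = ⊥-elim (<⇒≱ two (subst (count h ≤_) (count-singleton u) (count-mono h⊆u)))
  where
  h⊆u : h ⊆ᵇ (_== u)
  h⊆u i hi with i ≟ u
  ... | yes _ = refl
  ... | no i≢u = ⊥-elim (none (i , hi , i≢u))

count≡1⇒unique : ∀ {n} (h : Fin n → Bool) → count h ≡ 1 → ∀ {i j} → h i ≡ true → h j ≡ true → i ≡ j
count≡1⇒unique h one {i} {j} hi hj with i ≟ j
... | yes i≡j = i≡j
... | no i≢j = ⊥-elim (<⇒≱ ≤-refl (subst₂ _≤_ (count-pair i≢j) one (count-mono pair⊆h)))
  where
  pair⊆h : (λ e → (e == i) ∨ (e == j)) ⊆ᵇ h
  pair⊆h e e∈ with e ≟ i | e ≟ j
  ... | yes refl | _ = hi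
  ... | no _ | yes refl = hj

count-splitAt : ∀ m {n} (h : Fin (m + n) → Bool) → count h ≡ count (λ a → h (a ↑ˡ n)) + count (λ b → h (m ↑ʳ b))
count-splitAt zero h = refl
count-splitAt (suc m) h =
  trans (cong (toℕᵇ (h zero) +_) (count-splitAt m (h ∘ suc))) (sym (+-assoc (toℕᵇ (h zero)) _ _))

∣∣≡count : ∀ {n} (p : Subset n) → ∣ p ∣ ≡ count (lookup p)
∣∣≡count [] = refl
∣∣≡count (true ∷ p) = cong suc (∣∣≡count p)
∣∣≡count (false ∷ p) = ∣∣≡count p

∣tabulate∣≡count : ∀ {n} (h : Fin n → Bool) → ∣ tabulate h ∣ ≡ count h
∣tabulate∣≡count h = trans (∣∣≡count (tabulate h)) (count-cong (lookup∘tabulate h))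

count-injection : ∀ {m n} (P : Fin m → Bool) (Q : Fin n → Bool) (g : ∀ t → P t ≡ true → Fin n) →
  (∀ t pt → Q (g t pt) ≡ true) → (∀ {t t'} pt pt' → g t pt ≡ g t' pt' → t ≡ t') → count P ≤ count Q
count-injection {zero} P Q g into inj = z≤n
count-injection {suc m} P Q g into inj with P zero in p0
... | false = count-injection (P ∘ suc) Q (g ∘ suc) (into ∘ suc) (λ pt pt' → Fin.suc-injective ∘ inj pt pt')
... | true = subst (suc (count (P ∘ suc)) ≤_) (sym (count-remove Q (into zero p0))) (s≤s rest)
  where
  Q-g₀ : Fin _ → Bool
  Q-g₀ j = Q j ∧ not (j == g zero p0)
  into' : ∀ t pt → Q-g₀ (g (suc t) pt) ≡ true
  into' t pt rewrite into (suc t) pt | ==-≢ (Fin.0≢1+n ∘ sym ∘ inj pt p0) = refl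
  rest : count (P ∘ suc) ≤ count Q-g₀
  rest = count-injection (P ∘ suc) Q-g₀ (g ∘ suc) into' (λ pt pt' → Fin.suc-injective ∘ inj pt pt')

rank : ∀ {n} → (Fin n → Bool) → Fin n → ℕ
rank h w = count (λ e → h e ∧ (toℕ e <ᵇ toℕ w))

module _ {n} (h : Fin n → Bool) {w : Fin n} (hw : h w ≡ true) where

  private
    below : Fin n → Fin n → Bool
    below w e = h e ∧ (toℕ e <ᵇ toℕ w)

    below-lt : ∀ {e w} → below w e ≡ true → toℕ e < toℕ w
    below-lt {e} {w} b = ℕ.<ᵇ⇒< (toℕ e) (toℕ w) (Equivalence.from T-≡ (∧-conicalʳ _ _ b))

    count-below⁺ : count (λ e → below w e ∨ (e == w)) ≡ suc (rank h w)
    count-below⁺ = count-insert w w∉ (∨-==-self (below w) w) (λ e e≢w → sym (∨-==-other (below w) e≢w))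
      where
      w∉ : below w w ≡ false
      w∉ with below w w in b
      ... | true = ⊥-elim (Fin.<-irrefl refl (below-lt b))
      ... | false = refl

  rank<count : rank h w < count h
  rank<count = subst (_≤ count h) count-below⁺ (count-mono below⁺⊆h)
    where
    below⁺⊆h : (λ e → below w e ∨ (e == w)) ⊆ᵇ h
    below⁺⊆h e b with ∨-==-cases (below w) b
    ... | inj₁ b' = ∧-conicalˡ _ _ b'
    ... | inj₂ refl = hw

  rank-strict : ∀ {w'} → toℕ w < toℕ w' → rank h w < rank h w'
  rank-strict {w'} w<w' = subst (_≤ rank h w') count-below⁺ (count-mono below⁺⊆below')
    where
    lt⇒below : ∀ {e} → h e ≡ true → toℕ e < toℕ w' → below w' e ≡ true
    lt⇒below {e} he e<w' rewrite he = Equivalence.to T-≡ (ℕ.<⇒<ᵇ e<w')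
    below⁺⊆below' : (λ e → below w e ∨ (e == w)) ⊆ᵇ below w'
    below⁺⊆below' e b with ∨-==-cases (below w) b
    ... | inj₁ b' = lt⇒below (∧-conicalˡ _ _ b') (Fin.<-trans (below-lt b') w<w')
    ... | inj₂ refl = lt⇒below hw w<w'

rank-injective : ∀ {n} (h : Fin n → Bool) {a b} → h a ≡ true → h b ≡ true → rank h a ≡ rank h b → a ≡ b
rank-injective h {a} {b} ha hb eq with Fin.<-cmp a b
... | tri< a<b _ _ = ⊥-elim (ℕ.<-irrefl eq (rank-strict h ha a<b))
... | tri≈ _ a≡b _ = a≡b
... | tri> _ _ b<a = ⊥-elim (ℕ.<-irrefl (sym eq) (rank-strict h hb b<a))

-- Subsets that differ in one element

lookup-ext : ∀ {n} {p q : Subset n} → (∀ i → lookup p i ≡ lookup q i) → p ≡ q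
lookup-ext {p = p} {q} eq = trans (sym (tabulate∘lookup p)) (trans (tabulate-cong eq) (tabulate∘lookup q))

lookup-─ : ∀ {n} (p q : Subset n) i → lookup (p ─ q) i ≡ (lookup p i ∧ not (lookup q i))
lookup-─ (a ∷ p) (true ∷ q) zero = sym (∧-zeroʳ a)
lookup-─ (a ∷ p) (false ∷ q) zero = sym (∧-identityʳ a)
lookup-─ (a ∷ p) (b ∷ q) (suc i) = lookup-─ p q i

lookup-⁅⁆ : ∀ {n} (u i : Fin n) → lookup ⁅ u ⁆ i ≡ (i == u)
lookup-⁅⁆ u i with i ≟ u
... | yes refl = []=⇒lookup (x∈⁅x⁆ u)
... | no i≢u with lookup ⁅ u ⁆ i in eq
... | true = ⊥-elim (i≢u (x∈⁅y⁆⇒x≡y u (lookup⇒[]= i ⁅ u ⁆ eq)))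
... | false = refl

∈∉⇒≢ : ∀ {n} {p : Subset n} {a b} → lookup p a ≡ true → lookup p b ≡ false → a ≢ b
∈∉⇒≢ a∈ b∉ refl with trans (sym a∈) b∉
... | ()

record Exchange {n} (I J : Subset n) (u x : Fin n) : Set where
  field
    u∈I : lookup I u ≡ true
    u∉J : lookup J u ≡ false
    x∈J : lookup J x ≡ true
    x∉I : lookup I x ≡ false
    I-u⊆J : ∀ e → e ≢ u → lookup I e ≡ true → lookup J e ≡ true
    J-x⊆I : ∀ e → e ≢ x → lookup J e ≡ true → lookup I e ≡ true

module _ {n} {I J : Subset n} {u x : Fin n} (ex : Exchange I J u x) where
  open Exchange ex

  exchange-sym : Exchange J I x u
  exchange-sym = record { u∈I = x∈J ; u∉J = x∉I ; x∈J = u∈I ; x∉I = u∉J ; I-u⊆J = J-x⊆I ; J-x⊆I = I-u⊆J }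

  exchange-added : ∀ {a} → lookup J a ≡ true → lookup I a ≡ false → a ≡ x
  exchange-added {a} a∈J a∉I with a ≟ x
  ... | yes a≡x = a≡x
  ... | no a≢x with trans (sym (J-x⊆I a a≢x a∈J)) a∉I
  ... | ()

  exchange-removed : ∀ {a} → lookup I a ≡ true → lookup J a ≡ false → a ≡ u
  exchange-removed {a} a∈I a∉J with a ≟ u
  ... | yes a≡u = a≡u
  ... | no a≢u with trans (sym (I-u⊆J a a≢u a∈I)) a∉J
  ... | ()

  exchange-added-unique : ∀ {a b} → lookup J a ≡ true → lookup I a ≡ false →
    lookup J b ≡ true → lookup I b ≡ false → a ≡ b
  exchange-added-unique a∈J a∉I b∈J b∉I = trans (exchange-added a∈J a∉I) (sym (exchange-added b∈J b∉I))

  exchange-removed-unique : ∀ {a b} → lookup I a ≡ true → lookup J a ≡ false →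
    lookup I b ≡ true → lookup J b ≡ false → a ≡ b
  exchange-removed-unique a∈I a∉J b∈I b∉J = trans (exchange-removed a∈I a∉J) (sym (exchange-removed b∈I b∉J))

  exchange-unchanged : ∀ e → e ≢ u → e ≢ x → lookup J e ≡ lookup I e
  exchange-unchanged e e≢u e≢x with lookup I e in e∈I | lookup J e in e∈J
  ... | true | true = refl
  ... | false | false = refl
  ... | true | false with trans (sym (I-u⊆J e e≢u e∈I)) e∈J
  ... | ()
  exchange-unchanged e e≢u e≢x | false | true with trans (sym (J-x⊆I e e≢x e∈J)) e∈I
  ... | ()

  exchange-member : ∀ {a} → lookup J a ≡ true → a ≡ x ⊎ (lookup I a ≡ true × a ≢ u)
  exchange-member {a} a∈J with a ≟ x
  ... | yes a≡x = inj₁ a≡x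
  ... | no a≢x = inj₂ (J-x⊆I a a≢x a∈J , ∈∉⇒≢ {p = J} a∈J u∉J)

  exchange⇒─≡⁅⁆ : I ─ J ≡ ⁅ u ⁆
  exchange⇒─≡⁅⁆ = lookup-ext λ e → trans (lookup-─ I J e) (trans (pointwise e) (sym (lookup-⁅⁆ u e)))
    where
    pointwise : ∀ e → (lookup I e ∧ not (lookup J e)) ≡ (e == u)
    pointwise e with e ≟ u
    ... | yes refl rewrite u∈I | u∉J = refl
    ... | no e≢u with lookup I e in e∈I
    ... | false = refl
    ... | true rewrite I-u⊆J e e≢u e∈I = refl

exchange-pointwise : ∀ {n} {I J : Subset n} {u x} → lookup I u ≡ true → lookup J u ≡ false →
  lookup J x ≡ true → lookup I x ≡ false → (∀ e → e ≢ u → e ≢ x → lookup I e ≡ lookup J e) → Exchange I J u x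
exchange-pointwise {I = I} {J} {u} {x} u∈I u∉J x∈J x∉I agree = record
  { u∈I = u∈I ; u∉J = u∉J ; x∈J = x∈J ; x∉I = x∉I ; I-u⊆J = I-u⊆J ; J-x⊆I = J-x⊆I }
  where
  I-u⊆J : ∀ e → e ≢ u → lookup I e ≡ true → lookup J e ≡ true
  I-u⊆J e e≢u e∈I with e ≟ x
  ... | yes refl = x∈J
  ... | no e≢x = trans (sym (agree e e≢u e≢x)) e∈I
  J-x⊆I : ∀ e → e ≢ x → lookup J e ≡ true → lookup I e ≡ true
  J-x⊆I e e≢x e∈J with e ≟ u
  ... | yes refl = ⊥-elim (∈∉⇒≢ {p = J} e∈J u∉J refl)
  ... | no e≢u = trans (agree e e≢u e≢x) e∈J

─≡⁅⁆⇒removal : ∀ {n} {A B : Subset n} {w} → A ─ B ≡ ⁅ w ⁆ →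
  lookup A w ≡ true × lookup B w ≡ false × (∀ e → e ≢ w → lookup A e ≡ true → lookup B e ≡ true)
─≡⁅⁆⇒removal {A = A} {B} {w} A─B = ∧-conicalˡ _ _ at-w , not-injective (∧-conicalʳ _ _ at-w) , elsewhere
  where
  pointwise : ∀ e → (lookup A e ∧ not (lookup B e)) ≡ (e == w)
  pointwise e = trans (sym (lookup-─ A B e)) (trans (cong (λ S → lookup S e) A─B) (lookup-⁅⁆ w e))
  at-w : (lookup A w ∧ not (lookup B w)) ≡ true
  at-w = trans (pointwise w) (==-refl w)
  elsewhere : ∀ e → e ≢ w → lookup A e ≡ true → lookup B e ≡ true
  elsewhere e e≢w e∈A with trans (pointwise e) (==-≢ e≢w)
  ... | B-false rewrite e∈A = not-injective {y = true} B-false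

─≡⁅⁆⇒exchange : ∀ {n} {I J : Subset n} {u x} → I ─ J ≡ ⁅ u ⁆ → J ─ I ≡ ⁅ x ⁆ → Exchange I J u x
─≡⁅⁆⇒exchange I─J J─I with ─≡⁅⁆⇒removal I─J | ─≡⁅⁆⇒removal J─I
... | u∈I , u∉J , I-u⊆J | x∈J , x∉I , J-x⊆I =
  record { u∈I = u∈I ; u∉J = u∉J ; x∈J = x∈J ; x∉I = x∉I ; I-u⊆J = I-u⊆J ; J-x⊆I = J-x⊆I }

exchange-unique : ∀ {n} {I A B : Subset n} {u x} → Exchange I A u x → Exchange I B u x → A ≡ B
exchange-unique {A = A} {B} {u} {x} exA exB = lookup-ext pointwise
  where
  pointwise : ∀ e → lookup A e ≡ lookup B e
  pointwise e with e ≟ u | e ≟ x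
  ... | yes refl | _ = trans (Exchange.u∉J exA) (sym (Exchange.u∉J exB))
  ... | no _ | yes refl = trans (Exchange.x∈J exA) (sym (Exchange.x∈J exB))
  ... | no e≢u | no e≢x = trans (exchange-unchanged exA e e≢u e≢x) (sym (exchange-unchanged exB e e≢u e≢x))

exchange-compose : ∀ {n} {I J₁ J₂ : Subset n} {u x₁ x₂} →
  Exchange I J₁ u x₁ → Exchange I J₂ u x₂ → x₁ ≢ x₂ → Exchange J₁ J₂ x₁ x₂
exchange-compose {I = I} {J₁} {J₂} {u} {x₁} {x₂} ex₁ ex₂ x₁≢x₂ = exchange-pointwise
  (Exchange.x∈J ex₁)
  (trans (exchange-unchanged ex₂ x₁ (u≢x ex₁ ∘ sym) x₁≢x₂) (Exchange.x∉I ex₁))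
  (Exchange.x∈J ex₂)
  (trans (exchange-unchanged ex₁ x₂ (u≢x ex₂ ∘ sym) (x₁≢x₂ ∘ sym)) (Exchange.x∉I ex₂))
  agree
  where
  u≢x : ∀ {J x} → Exchange I J u x → u ≢ x
  u≢x ex = ∈∉⇒≢ {p = I} (Exchange.u∈I ex) (Exchange.x∉I ex)
  agree : ∀ e → e ≢ x₁ → e ≢ x₂ → lookup J₁ e ≡ lookup J₂ e
  agree e e≢x₁ e≢x₂ with e ≟ u
  ... | yes refl = trans (Exchange.u∉J ex₁) (sym (Exchange.u∉J ex₂))
  ... | no e≢u = trans (exchange-unchanged ex₁ e e≢u e≢x₁) (sym (exchange-unchanged ex₂ e e≢u e≢x₂))

exchange-count : ∀ {n} {I J : Subset n} {u x} → Exchange I J u x → count (lookup I) ≡ count (lookup J)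
exchange-count {I = I} {J} {u} {x} ex = begin
  count (lookup I)                              ≡⟨ count-remove (lookup I) u∈I ⟩
  suc (count (λ e → lookup I e ∧ not (e == u))) ≡⟨ cong suc (count-cong pointwise) ⟩
  suc (count (λ e → lookup J e ∧ not (e == x))) ≡⟨ sym (count-remove (lookup J) x∈J) ⟩
  count (lookup J)                              ∎
  where
  open Exchange ex
  open ≡-Reasoning
  pointwise : ∀ e → (lookup I e ∧ not (e == u)) ≡ (lookup J e ∧ not (e == x))
  pointwise e with e ≟ u | e ≟ x
  ... | yes refl | _ rewrite u∉J = ∧-zeroʳ _
  ... | no _ | yes refl rewrite x∉I = sym (∧-zeroʳ _)
  ... | no e≢u | no e≢x = cong (_∧ true) (sym (exchange-unchanged ex e e≢u e≢x))

replace : ∀ {n} → Subset n → Fin n → Fin n → Subset n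
replace J p s = tabulate λ e → (lookup J e ∧ not (e == p)) ∨ (e == s)

exchange-replace : ∀ {n} (J : Subset n) {p s} → lookup J p ≡ true → lookup J s ≡ false → Exchange J (replace J p s) p s
exchange-replace J {p} {s} p∈J s∉J = exchange-pointwise p∈J p∉ s∈ s∉J agree
  where
  entry : ∀ e → lookup (replace J p s) e ≡ ((lookup J e ∧ not (e == p)) ∨ (e == s))
  entry = lookup∘tabulate _
  p∉ : lookup (replace J p s) p ≡ false
  p∉ rewrite entry p | ==-refl p | ==-≢ (∈∉⇒≢ {p = J} p∈J s∉J) | ∧-zeroʳ (lookup J p) = refl
  s∈ : lookup (replace J p s) s ≡ true
  s∈ rewrite entry s | ==-refl s = ∨-zeroʳ _
  agree : ∀ e → e ≢ p → e ≢ s → lookup J e ≡ lookup (replace J p s) e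
  agree e e≢p e≢s rewrite entry e | ==-≢ e≢p | ==-≢ e≢s | ∧-identityʳ (lookup J e) = sym (∨-identityʳ _)

edge-sym : ∀ (G : Graph) {u v} → Edge G u v → Edge G v u
edge-sym G {u} {v} e = trans (adj-sym G v u) e

edge⇒≢ : ∀ (G : Graph) {u v} → Edge G u v → u ≢ v
edge⇒≢ G {u} e refl with trans (sym e) (irrefl G u)
... | ()

adj-false⇒¬Edge : ∀ (G : Graph) {u v} → adj G u v ≡ false → ¬ Edge G u v
adj-false⇒¬Edge G f e with trans (sym e) f
... | ()

Independentᵇ : (G : Graph) → Subset (n G) → Set
Independentᵇ G I = ∀ u v → lookup I u ≡ true → lookup I v ≡ true → adj G u v ≡ false

fromIsIndependent : ∀ G {I} → IsIndependent G I → Independentᵇ G I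
fromIsIndependent G ind u v u∈ v∈ = ind u v (lookup⇒[]= u _ u∈) (lookup⇒[]= v _ v∈)

toIsIndependent : ∀ G {I} → Independentᵇ G I → IsIndependent G I
toIsIndependent G ind u v u∈ v∈ = ind u v ([]=⇒lookup u∈) ([]=⇒lookup v∈)

module _ (G : Graph) where

  TSAdj⇒exchange : ∀ {I J} → TSAdj G I J → ∃[ u ] ∃[ x ] Exchange I J u x × Edge G u x
  TSAdj⇒exchange (u , x , I─J , J─I , e) = u , x , ─≡⁅⁆⇒exchange I─J J─I , e

  exchange⇒TSAdj : ∀ {I J u x} → Exchange I J u x → Edge G u x → TSAdj G I J
  exchange⇒TSAdj {u = u} {x} ex e = u , x , exchange⇒─≡⁅⁆ ex , exchange⇒─≡⁅⁆ (exchange-sym ex) , e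

  exchange-independent : ∀ {I J u x} → Exchange I J u x → Independentᵇ G I →
    (∀ b → lookup I b ≡ true → b ≢ u → adj G x b ≡ false) → Independentᵇ G J
  exchange-independent ex indI x-free a b a∈J b∈J with exchange-member ex a∈J | exchange-member ex b∈J
  ... | inj₁ refl | inj₁ refl = irrefl G a
  ... | inj₁ refl | inj₂ (b∈I , b≢u) = x-free b b∈I b≢u
  ... | inj₂ (a∈I , a≢u) | inj₁ refl = trans (adj-sym G a b) (x-free a a∈I a≢u)
  ... | inj₂ (a∈I , _) | inj₂ (b∈I , _) = indI a b a∈I b∈I

  triangle-same-removal : ∀ {I A B a b c d p s} → Independentᵇ G I →
    Exchange I A a b → Exchange I B c d → Exchange A B p s → Edge G p s → a ≡ c
  triangle-same-removal {a = a} {c = c} {p = p} {s} indI exA exB exAB e with a ≟ c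
  ... | yes a≡c = a≡c
  ... | no a≢c = ⊥-elim (adj-false⇒¬Edge G (indI c a (Exchange.u∈I exB) (Exchange.u∈I exA)) c-a)
    where
    a≡s : a ≡ s
    a≡s = exchange-added exAB (Exchange.I-u⊆J exB a a≢c (Exchange.u∈I exA)) (Exchange.u∉J exA)
    c≡p : c ≡ p
    c≡p = exchange-removed exAB (Exchange.I-u⊆J exA c (a≢c ∘ sym) (Exchange.u∈I exB)) (Exchange.u∉J exB)
    c-a : Edge G c a
    c-a rewrite c≡p | a≡s = e

  clique-insert : ∀ {C w} → IsClique G C → (∀ v → v ∈ C → Edge G w v) → IsClique G (C ∪ ⁅ w ⁆)
  clique-insert {C} {w} cl w-adj a b a∈ b∈ a≢b with x∈p∪q⁻ C ⁅ w ⁆ a∈ | x∈p∪q⁻ C ⁅ w ⁆ b∈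
  ... | inj₁ a∈C | inj₁ b∈C = cl a b a∈C b∈C a≢b
  ... | inj₂ a∈w | inj₁ b∈C rewrite x∈⁅y⁆⇒x≡y w a∈w = w-adj b b∈C
  ... | inj₁ a∈C | inj₂ b∈w rewrite x∈⁅y⁆⇒x≡y w b∈w = edge-sym G (w-adj a a∈C)
  ... | inj₂ a∈w | inj₂ b∈w = ⊥-elim (a≢b (trans (x∈⁅y⁆⇒x≡y w a∈w) (sym (x∈⁅y⁆⇒x≡y w b∈w))))

∣∪⁅⁆∣ : ∀ {n} (C : Subset n) {w} → lookup C w ≡ false → ∣ C ∪ ⁅ w ⁆ ∣ ≡ suc ∣ C ∣
∣∪⁅⁆∣ C {w} w∉C = begin
  ∣ C ∪ ⁅ w ⁆ ∣              ≡⟨ ∣∣≡count (C ∪ ⁅ w ⁆) ⟩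
  count (lookup (C ∪ ⁅ w ⁆)) ≡⟨ count-insert w w∉C w∈ agree ⟩
  suc (count (lookup C))     ≡⟨ cong suc (sym (∣∣≡count C)) ⟩
  suc ∣ C ∣                  ∎
  where
  open ≡-Reasoning
  entry : ∀ e → lookup (C ∪ ⁅ w ⁆) e ≡ (lookup C e ∨ (e == w))
  entry e = trans (lookup-zipWith _∨_ e C ⁅ w ⁆) (cong (lookup C e ∨_) (lookup-⁅⁆ w e))
  w∈ : lookup (C ∪ ⁅ w ⁆) w ≡ true
  w∈ rewrite entry w | ==-refl w = ∨-zeroʳ _
  agree : ∀ e → e ≢ w → lookup C e ≡ lookup (C ∪ ⁅ w ⁆) e
  agree e e≢w rewrite entry e | ==-≢ e≢w = sym (∨-identityʳ _)

module SplitGraph (F : Graph) (K : Subset (n F)) (ks : IsKSPartition F K) where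

  ∈∁K⇒∉K : ∀ {w} → w ∈ ∁ K → lookup K w ≡ false
  ∈∁K⇒∉K {w} w∈S = not-injective {y = false} (trans (sym (lookup-map w not K)) ([]=⇒lookup w∈S))

  ∉K⇒∈∁K : ∀ {w} → lookup K w ≡ false → w ∈ ∁ K
  ∉K⇒∈∁K {w} w∉K = lookup⇒[]= w (∁ K) (trans (lookup-map w not K) (cong not w∉K))

  K-edge : ∀ {u v} → lookup K u ≡ true → lookup K v ≡ true → u ≢ v → Edge F u v
  K-edge {u} {v} u∈K v∈K = proj₁ ks u v (lookup⇒[]= u K u∈K) (lookup⇒[]= v K v∈K)

  S-nonadjacent : ∀ {u v} → lookup K u ≡ false → lookup K v ≡ false → adj F u v ≡ false
  S-nonadjacent u∉K v∉K = proj₂ ks _ _ (∉K⇒∈∁K u∉K) (∉K⇒∈∁K v∉K)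

  S-neighbour∈K : ∀ {w y} → lookup K w ≡ false → Edge F w y → lookup K y ≡ true
  S-neighbour∈K {w} {y} w∉K e with lookup K y in y∈K
  ... | true = refl
  ... | false = ⊥-elim (adj-false⇒¬Edge F (S-nonadjacent w∉K y∈K) e)

  S-neighbour : Fin (n F) → Fin (n F) → Bool
  S-neighbour v e = adj F v e ∧ not (lookup K e)

  ∣S-neighbours∣ : ∀ v → ∣ Nbhd F v ∩ ∁ K ∣ ≡ count (S-neighbour v)
  ∣S-neighbours∣ v = trans (∣∣≡count (Nbhd F v ∩ ∁ K)) (count-cong λ e →
    trans (lookup-zipWith _∧_ e (Nbhd F v) (∁ K)) (cong₂ _∧_ (lookup∘tabulate (adj F v) e) (lookup-map e not K)))

module Necessity (k : ℕ) (2≤k : 2 ≤ k) (F : Graph) (connected : Connected F) (K : Subset (n F))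
  (kmax : IsKMaxKSPartition F K) (G : Graph) (iso : IsoToTS k F G) where

  open SplitGraph F K (proj₁ kmax)

  f : Fin (n F) → Subset (n G)
  f = proj₁ iso

  f-injective : ∀ x y → f x ≡ f y → x ≡ y
  f-injective = proj₁ (proj₂ (proj₂ iso))

  f-surjective : ∀ J → IsTSVertex k G J → ∃ λ x → f x ≡ J
  f-surjective = proj₁ (proj₂ (proj₂ (proj₂ iso)))

  f-reflects-edges : ∀ x y → TSAdj G (f x) (f y) → Edge F x y
  f-reflects-edges = proj₂ (proj₂ (proj₂ (proj₂ (proj₂ iso))))

  f-independent : ∀ x → Independentᵇ G (f x)
  f-independent x = fromIsIndependent G (proj₁ (proj₁ (proj₂ iso) x))

  f-count : ∀ x → count (lookup (f x)) ≡ k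
  f-count x = trans (sym (∣∣≡count (f x))) (proj₂ (proj₁ (proj₂ iso) x))

  edge-exchange : ∀ {x y} → Edge F x y → ∃[ p ] ∃[ s ] Exchange (f x) (f y) p s × Edge G p s
  edge-exchange {x} {y} e = TSAdj⇒exchange G (proj₁ (proj₂ (proj₂ (proj₂ (proj₂ iso)))) x y e)

  removed added : ∀ {x y} → Edge F x y → Fin (n G)
  removed e = proj₁ (edge-exchange e)
  added e = proj₁ (proj₂ (edge-exchange e))

  removed-exchange : ∀ {x y} (e : Edge F x y) → Exchange (f x) (f y) (removed e) (added e)
  removed-exchange e = proj₁ (proj₂ (proj₂ (edge-exchange e)))

  removed-added : ∀ {x y} (e : Edge F x y) → Edge G (removed e) (added e)
  removed-added e = proj₂ (proj₂ (proj₂ (edge-exchange e)))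

  triangle-removal : ∀ {v a b} (va : Edge F v a) (vb : Edge F v b) → Edge F a b → removed va ≡ removed vb
  triangle-removal {v} va vb ab = triangle-same-removal G (f-independent v)
    (removed-exchange va) (removed-exchange vb) (removed-exchange ab) (removed-added ab)

  some-neighbour : ∀ {z y} → z ≢ y → ∃[ t ] Edge F z t
  some-neighbour {z} {y} z≢y with connected z y
  ... | here = ⊥-elim (z≢y refl)
  ... | step {w = t} e _ = t , e

  module DoubleExchange {v₀ t₁ t₂ u u' x₁ x₂}
    (v₀∈K : lookup K v₀ ≡ true) (t₁≢t₂ : t₁ ≢ t₂) (¬t₁t₂ : ¬ Edge F t₁ t₂)
    (ex₁ : Exchange (f v₀) (f t₁) u x₁) (ux₁ : Edge G u x₁)
    (ex₂ : Exchange (f v₀) (f t₂) u x₂) (ux₂ : Edge G u x₂)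
    (u'∈I : lookup (f v₀) u' ≡ true) (u'≢u : u' ≢ u) where

    I : Subset (n G)
    I = f v₀

    x₁≢x₂ : x₁ ≢ x₂
    x₁≢x₂ refl = t₁≢t₂ (f-injective t₁ t₂ (exchange-unique ex₁ ex₂))

    x₁x₂-nonadjacent : adj G x₁ x₂ ≡ false
    x₁x₂-nonadjacent with adj G x₁ x₂ in e
    ... | true = ⊥-elim (¬t₁t₂ (f-reflects-edges t₁ t₂ (exchange⇒TSAdj G (exchange-compose ex₁ ex₂ x₁≢x₂) e)))
    ... | false = refl

    u'∈f : ∀ {t x} → Exchange I (f t) u x → lookup (f t) u' ≡ true
    u'∈f ex = Exchange.I-u⊆J ex u' u'≢u u'∈I

    x₂∉f₁ : lookup (f t₁) x₂ ≡ false
    x₂∉f₁ = trans (exchange-unchanged ex₁ x₂ (∈∉⇒≢ {p = I} (Exchange.u∈I ex₂) (Exchange.x∉I ex₂) ∘ sym) (x₁≢x₂ ∘ sym))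
                  (Exchange.x∉I ex₂)

    Z : Subset (n G)
    Z = replace (f t₁) u' x₂

    exZ : Exchange (f t₁) Z u' x₂
    exZ = exchange-replace (f t₁) (u'∈f ex₁) x₂∉f₁

    Z-independent : Independentᵇ G Z
    Z-independent = exchange-independent G exZ (f-independent t₁) x₂-free
      where
      x₂-free : ∀ b → lookup (f t₁) b ≡ true → b ≢ u' → adj G x₂ b ≡ false
      x₂-free b b∈f₁ _ with b ≟ x₁
      ... | yes refl = trans (adj-sym G x₂ b) x₁x₂-nonadjacent
      ... | no b≢x₁ = f-independent t₂ x₂ b (Exchange.x∈J ex₂)
        (Exchange.I-u⊆J ex₂ b (∈∉⇒≢ {p = f t₁} b∈f₁ (Exchange.u∉J ex₁)) (Exchange.J-x⊆I ex₁ b b≢x₁ b∈f₁))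

    Z-preimage : ∃ λ z → f z ≡ Z
    Z-preimage = f-surjective Z (toIsIndependent G Z-independent ,
      trans (∣∣≡count Z) (trans (sym (exchange-count exZ)) (f-count t₁)))

    z : Fin (n F)
    z = proj₁ Z-preimage

    fz≡Z : f z ≡ Z
    fz≡Z = proj₂ Z-preimage

    x₁∈Z : lookup Z x₁ ≡ true
    x₁∈Z = Exchange.I-u⊆J exZ x₁ (∈∉⇒≢ {p = I} u'∈I (Exchange.x∉I ex₁) ∘ sym) (Exchange.x∈J ex₁)

    x₂∈Z : lookup Z x₂ ≡ true
    x₂∈Z = Exchange.x∈J exZ

    ¬exchange-I-Z : ∀ {p s} → Exchange I Z p s → ⊥
    ¬exchange-I-Z ex = x₁≢x₂ (exchange-added-unique ex x₁∈Z (Exchange.x∉I ex₁) x₂∈Z (Exchange.x∉I ex₂))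

    ¬v₀-z : ¬ Edge F v₀ z
    ¬v₀-z e with edge-exchange e
    ... | _ , _ , ex , _ = ¬exchange-I-Z (subst (λ J → Exchange I J _ _) fz≡Z ex)

    z≢v₀ : z ≢ v₀
    z≢v₀ z≡v₀ = ∈∉⇒≢ {p = Z} x₁∈Z x₁∉Z refl
      where
      x₁∉Z : lookup Z x₁ ≡ false
      x₁∉Z = trans (cong (λ J → lookup J x₁) (sym fz≡Z))
                   (trans (cong (λ y → lookup (f y) x₁) z≡v₀) (Exchange.x∉I ex₁))

    -- If Y = f y meets {x₁, x₂} in exactly xa, the step Y → Z must remove u' and add xb.
    mixed-edge : ∀ {Y p s q t xa xb} → Independentᵇ G Y → Exchange I Y p s → Exchange Y Z q t → Edge G q t →
      Edge G u xa → lookup Y xa ≡ true → lookup Y xb ≡ false → lookup Z xb ≡ true → Edge G u' xb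
    mixed-edge {Y} {p} {s} {q} {t} {xa} {xb} indY exY exYZ qt uxa xa∈Y xb∉Y xb∈Z =
      subst₂ (Edge G) (sym u'≡q) (sym xb≡t) qt
      where
      u∉Y : lookup Y u ≡ false
      u∉Y with lookup Y u in u∈Y
      ... | false = refl
      ... | true = ⊥-elim (adj-false⇒¬Edge G (indY u xa u∈Y xa∈Y) uxa)
      u≡p : u ≡ p
      u≡p = exchange-removed exY (Exchange.u∈I ex₁) u∉Y
      u'≡q : u' ≡ q
      u'≡q = exchange-removed exYZ (Exchange.I-u⊆J exY u' (λ u'≡p → u'≢u (trans u'≡p (sym u≡p))) u'∈I)
                                   (Exchange.u∉J exZ)
      xb≡t : xb ≡ t
      xb≡t = exchange-added exYZ xb∈Z xb∉Y

    ¬common-neighbour : ∀ y {p s q t} → Exchange I (f y) p s → Exchange (f y) Z q t → Edge G q t → ⊥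
    ¬common-neighbour y exY exYZ qt with lookup (f y) x₁ in x₁∈Y | lookup (f y) x₂ in x₂∈Y
    ... | true | true = x₁≢x₂ (exchange-added-unique exY x₁∈Y (Exchange.x∉I ex₁) x₂∈Y (Exchange.x∉I ex₂))
    ... | false | false = x₁≢x₂ (exchange-added-unique exYZ x₁∈Z x₁∈Y x₂∈Z x₂∈Y)
    ... | true | false = adj-false⇒¬Edge G (f-independent t₂ u' x₂ (u'∈f ex₂) (Exchange.x∈J ex₂))
      (mixed-edge (f-independent y) exY exYZ qt ux₁ x₁∈Y x₂∈Y x₂∈Z)
    ... | false | true = adj-false⇒¬Edge G (f-independent t₁ u' x₁ (u'∈f ex₁) (Exchange.x∈J ex₁))
      (mixed-edge (f-independent y) exY exYZ qt ux₂ x₂∈Y x₁∈Y x₁∈Z)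

    absurd : ⊥
    absurd with lookup K z in z∈K
    ... | true = ¬v₀-z (K-edge v₀∈K z∈K (z≢v₀ ∘ sym))
    ... | false with some-neighbour z≢v₀
    ... | y , zy with y ≟ v₀
    ... | yes refl = ¬v₀-z (edge-sym F zy)
    ... | no y≢v₀ with edge-exchange (K-edge v₀∈K (S-neighbour∈K z∈K zy) (y≢v₀ ∘ sym)) | edge-exchange (edge-sym F zy)
    ... | _ , _ , exY , _ | _ , _ , exYZ , qt =
      ¬common-neighbour y exY (subst (λ J → Exchange (f y) J _ _) fz≡Z exYZ) qt

  distinct-removals : ∀ {v₀ t₁ t₂} → lookup K v₀ ≡ true → t₁ ≢ t₂ → ¬ Edge F t₁ t₂ →
    (e₁ : Edge F v₀ t₁) (e₂ : Edge F v₀ t₂) → removed e₁ ≢ removed e₂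
  distinct-removals {v₀} v₀∈K t₁≢t₂ ¬t₁t₂ e₁ e₂ same
    with count≥2⇒another (lookup (f v₀)) (subst (2 ≤_) (sym (f-count v₀)) 2≤k) (removed e₁)
  ... | u' , u'∈I , u'≢u = DoubleExchange.absurd v₀∈K t₁≢t₂ ¬t₁t₂
    (removed-exchange e₁) (removed-added e₁)
    (subst (λ u → Exchange (f v₀) (f _) u (added e₂)) (sym same) (removed-exchange e₂))
    (subst (λ u → Edge G u (added e₂)) (sym same) (removed-added e₂))
    u'∈I u'≢u

  S-non-neighbour : ∀ {w} → lookup K w ≡ false → ∃[ v ] lookup K v ≡ true × ¬ Edge F w v
  S-non-neighbour {w} w∉K with all? (λ v → (lookup K v ≟ᵇ true) →-dec (adj F w v ≟ᵇ true))
  ... | no ¬all with ¬∀⟶∃¬ (n F) _ (λ v → (lookup K v ≟ᵇ true) →-dec (adj F w v ≟ᵇ true)) ¬all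
  ... | v , ¬K⇒adj with lookup K v in v∈K
  ... | true = v , v∈K , λ e → ¬K⇒adj λ _ → e
  ... | false = ⊥-elim (¬K⇒adj λ ())
  S-non-neighbour {w} w∉K | yes all =
    ⊥-elim (<⇒≱ (≤-reflexive (sym (∣∪⁅⁆∣ K w∉K))) (proj₂ kmax (K ∪ ⁅ w ⁆) bigger-clique))
    where
    bigger-clique : IsClique F (K ∪ ⁅ w ⁆)
    bigger-clique = clique-insert F (proj₁ (proj₁ kmax)) λ v v∈K → all v ([]=⇒lookup v∈K)

  -- A non-neighbour v₃ ∈ K of w and two neighbours v₁, v₂ would let w and v₃ share the removal at v₁.
  S-neighbour-unique : ∀ {w v₁ v₂} → lookup K w ≡ false → Edge F w v₁ → Edge F w v₂ → v₁ ≡ v₂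
  S-neighbour-unique {w} {v₁} {v₂} w∉K wv₁ wv₂ with v₁ ≟ v₂ | S-non-neighbour w∉K
  ... | yes v₁≡v₂ | _ = v₁≡v₂
  ... | no v₁≢v₂ | v₃ , v₃∈K , ¬wv₃ = ⊥-elim (distinct-removals v₁∈K w≢v₃ ¬wv₃ v₁w v₁v₃ shared)
    where
    v₁∈K : lookup K v₁ ≡ true
    v₁∈K = S-neighbour∈K w∉K wv₁
    v₂∈K : lookup K v₂ ≡ true
    v₂∈K = S-neighbour∈K w∉K wv₂
    w≢v₃ : w ≢ v₃
    w≢v₃ w≡v₃ = ∈∉⇒≢ {p = K} v₃∈K w∉K (sym w≡v₃)
    K-edge-v₃ : ∀ {v} → lookup K v ≡ true → Edge F w v → Edge F v v₃
    K-edge-v₃ v∈K wv = K-edge v∈K v₃∈K λ v≡v₃ → ¬wv₃ (subst (Edge F w) v≡v₃ wv)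
    v₁w : Edge F v₁ w
    v₁w = edge-sym F wv₁
    v₁v₂ : Edge F v₁ v₂
    v₁v₂ = K-edge v₁∈K v₂∈K v₁≢v₂
    v₁v₃ : Edge F v₁ v₃
    v₁v₃ = K-edge-v₃ v₁∈K wv₁
    shared : removed v₁w ≡ removed v₁v₃
    shared = trans (sym (triangle-removal v₁v₂ v₁w (edge-sym F wv₂)))
                   (triangle-removal v₁v₂ v₁v₃ (K-edge-v₃ v₂∈K wv₂))

  K-nonempty : ∀ {w} → lookup K w ≡ false → ∃[ v ] lookup K v ≡ true
  K-nonempty {w} w∉K =
    count-witness (lookup K) (subst₂ _≤_ (∣⁅x⁆∣≡1 w) (∣∣≡count K) (proj₂ kmax ⁅ w ⁆ singleton-clique))
    where
    singleton-clique : IsClique F ⁅ w ⁆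
    singleton-clique a b a∈ b∈ a≢b = ⊥-elim (a≢b (trans (x∈⁅y⁆⇒x≡y w a∈) (sym (x∈⁅y⁆⇒x≡y w b∈))))

  S-degree≡1 : ∀ {w} → lookup K w ≡ false → ∣ Nbhd F w ∣ ≡ 1
  S-degree≡1 {w} w∉K with K-nonempty w∉K
  ... | v , v∈K with some-neighbour {w} {v} (λ w≡v → ∈∉⇒≢ {p = K} v∈K w∉K (sym w≡v))
  ... | t , wt = begin
    ∣ Nbhd F w ∣     ≡⟨ ∣tabulate∣≡count (adj F w) ⟩
    count (adj F w) ≡⟨ count-cong only-t ⟩
    count (_== t)   ≡⟨ count-singleton t ⟩
    1               ∎
    where
    open ≡-Reasoning
    only-t : ∀ e → adj F w e ≡ (e == t)
    only-t e with adj F w e in we | e ≟ t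
    ... | true | yes _ = refl
    ... | true | no e≢t = ⊥-elim (e≢t (S-neighbour-unique w∉K we wt))
    ... | false | yes refl = ⊥-elim (adj-false⇒¬Edge F we wt)
    ... | false | no _ = refl

  -- The S-neighbours of v together with v' are pairwise nonadjacent neighbours of v,
  -- so their removals are distinct elements of f v.
  S-degree<k : ∀ {v v'} → lookup K v ≡ true → lookup K v' ≡ true → v ≢ v' → count (S-neighbour v) < k
  S-degree<k {v} {v'} v∈K v'∈K v≢v' = subst₂ _≤_ count-P (f-count v)
    (count-injection P (lookup (f v)) (λ t → removed ∘ P⇒edge t) (λ t → Exchange.u∈I ∘ removed-exchange ∘ P⇒edge t)
                     injective)
    where
    P : Fin (n F) → Bool
    P e = S-neighbour v e ∨ (e == v')
    v'∉SN : S-neighbour v v' ≡ false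
    v'∉SN rewrite v'∈K = ∧-zeroʳ _
    count-P : count P ≡ suc (count (S-neighbour v))
    count-P = count-insert v' v'∉SN (∨-==-self (S-neighbour v) v') λ e e≢v' → sym (∨-==-other (S-neighbour v) e≢v')
    SN⇒∉K : ∀ {t} → S-neighbour v t ≡ true → lookup K t ≡ false
    SN⇒∉K {t} vt = not-injective {y = false} (∧-conicalʳ (adj F v t) _ vt)
    P⇒edge : ∀ t → P t ≡ true → Edge F v t
    P⇒edge t pt with ∨-==-cases (S-neighbour v) pt
    ... | inj₁ vt = ∧-conicalˡ _ _ vt
    ... | inj₂ refl = K-edge v∈K v'∈K v≢v'
    ¬SN-v' : ∀ {t} → S-neighbour v t ≡ true → ¬ Edge F t v'
    ¬SN-v' vt tv' = v≢v' (S-neighbour-unique (SN⇒∉K vt) (edge-sym F (∧-conicalˡ _ _ vt)) tv')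
    nonadjacent : ∀ {t t'} → P t ≡ true → P t' ≡ true → t ≢ t' → ¬ Edge F t t'
    nonadjacent pt pt' t≢t' with ∨-==-cases (S-neighbour v) pt | ∨-==-cases (S-neighbour v) pt'
    ... | inj₁ vt | inj₁ vt' = adj-false⇒¬Edge F (S-nonadjacent (SN⇒∉K vt) (SN⇒∉K vt'))
    ... | inj₁ vt | inj₂ refl = ¬SN-v' vt
    ... | inj₂ refl | inj₁ vt' = ¬SN-v' vt' ∘ edge-sym F
    ... | inj₂ refl | inj₂ refl = ⊥-elim (t≢t' refl)
    injective : ∀ {t t'} pt pt' → removed (P⇒edge t pt) ≡ removed (P⇒edge t' pt') → t ≡ t'
    injective {t} {t'} pt pt' same with t ≟ t'
    ... | yes t≡t' = t≡t'
    ... | no t≢t' =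
      ⊥-elim (distinct-removals v∈K t≢t' (nonadjacent pt pt' t≢t') (P⇒edge t pt) (P⇒edge t' pt') same)

  S-degree-bound : ∀ {v} → lookup K v ≡ true → count (S-neighbour v) ≤ k ∸ 1
  S-degree-bound {v} v∈K with count (S-neighbour v) in c
  ... | zero = z≤n
  ... | suc _ with count-witness (S-neighbour v) (subst (0 <_) (sym c) (s≤s z≤n))
  ... | w₀ , vw₀ with S-non-neighbour (not-injective {y = false} (∧-conicalʳ (adj F v w₀) _ vw₀))
  ... | v' , v'∈K , ¬w₀v' = ℕ.<⇒≤pred (subst (_< k) c (S-degree<k v∈K v'∈K v≢v'))
    where
    v≢v' : v ≢ v'
    v≢v' v≡v' = ¬w₀v' (subst (Edge F w₀) v≡v' (edge-sym F (∧-conicalˡ (adj F v w₀) _ vw₀)))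

  necessity : (∀ v → v ∈ K → ∣ Nbhd F v ∩ ∁ K ∣ ≤ k ∸ 1) × (∀ w → w ∈ ∁ K → ∣ Nbhd F w ∣ ≡ 1)
  necessity = (λ v v∈K → subst (_≤ k ∸ 1) (sym (∣S-neighbours∣ v)) (S-degree-bound ([]=⇒lookup v∈K)))
            , (λ w w∈S → S-degree≡1 (∈∁K⇒∉K w∈S))

module Sufficiency (m : ℕ) (F : Graph) (K : Subset (n F)) (ks : IsKSPartition F K)
  (bound : ∀ v → v ∈ K → ∣ Nbhd F v ∩ ∁ K ∣ ≤ suc m) (degree : ∀ w → w ∈ ∁ K → ∣ Nbhd F w ∣ ≡ 1) where

  open SplitGraph F K ks

  S-degree-bound : ∀ {v} → lookup K v ≡ true → count (S-neighbour v) ≤ suc m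
  S-degree-bound {v} v∈K = subst (_≤ suc m) (∣S-neighbours∣ v) (bound v (lookup⇒[]= v K v∈K))

  S-degree≡1 : ∀ {w} → lookup K w ≡ false → count (adj F w) ≡ 1
  S-degree≡1 {w} w∉K = trans (sym (∣tabulate∣≡count (adj F w))) (degree w (∉K⇒∈∁K w∉K))

  N : ℕ
  N = n F

  M : ℕ
  M = suc m

  -- Meaningful only on S, where it picks the unique neighbour.
  parent : Fin N → Fin N
  parent w with any? (λ v → adj F w v ≟ᵇ true)
  ... | yes (v , _) = v
  ... | no _ = w

  module _ {w} (w∉K : lookup K w ≡ false) where

    parent-edge : Edge F w (parent w)
    parent-edge with any? (λ v → adj F w v ≟ᵇ true)
    ... | yes (_ , e) = e
    ... | no none = ⊥-elim (none (count-witness (adj F w) (subst (0 <_) (sym (S-degree≡1 w∉K)) (s≤s z≤n))))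

    parent-unique : ∀ {v} → Edge F w v → v ≡ parent w
    parent-unique e = count≡1⇒unique (adj F w) (S-degree≡1 w∉K) e parent-edge

    parent∈K : lookup K (parent w) ≡ true
    parent∈K = S-neighbour∈K w∉K parent-edge

    parent≢ : parent w ≢ w
    parent≢ = edge⇒≢ F parent-edge ∘ sym

    child : S-neighbour (parent w) w ≡ true
    child rewrite edge-sym F parent-edge | w∉K = refl

  -- Below M on S by the degree bound, so mod only serves to land in Fin M.
  label : Fin N → Fin M
  label w = rank (S-neighbour (parent w)) w mod M

  toℕ-label : ∀ {w} → lookup K w ≡ false → toℕ (label w) ≡ rank (S-neighbour (parent w)) w
  toℕ-label {w} w∉K = trans (Fin.toℕ-fromℕ< _) (m<n⇒m%n≡m rank<M)
    where
    rank<M : rank (S-neighbour (parent w)) w < M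
    rank<M = ≤-trans (rank<count (S-neighbour (parent w)) (child w∉K)) (S-degree-bound (parent∈K w∉K))

  label-injective : ∀ {w₁ w₂} → lookup K w₁ ≡ false → lookup K w₂ ≡ false →
    parent w₁ ≡ parent w₂ → label w₁ ≡ label w₂ → w₁ ≡ w₂
  label-injective {w₁} {w₂} w₁∉K w₂∉K same eq =
    rank-injective (S-neighbour (parent w₂))
      (subst (λ v → S-neighbour v w₁ ≡ true) same (child w₁∉K)) (child w₂∉K) (begin
      rank (S-neighbour (parent w₂)) w₁ ≡⟨ cong (λ v → rank (S-neighbour v) w₁) (sym same) ⟩
      rank (S-neighbour (parent w₁)) w₁ ≡⟨ sym (toℕ-label w₁∉K) ⟩
      toℕ (label w₁)                    ≡⟨ cong toℕ eq ⟩
      toℕ (label w₂)                    ≡⟨ toℕ-label w₂∉K ⟩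
      rank (S-neighbour (parent w₂)) w₂ ∎)
    where open ≡-Reasoning

  vertex-adj : Bool → Bool → Fin N → Fin N → Bool
  vertex-adj true true a b = not (a == b)
  vertex-adj false false a b = not (a == b)
  vertex-adj true false a b = not (parent b == a)
  vertex-adj false true a b = not (parent a == b)

  label-adj : Fin N → Fin M → Bool
  label-adj a c = not (lookup K a) ∧ (c == label a)

  adjᴳ : Fin N ⊎ Fin M → Fin N ⊎ Fin M → Bool
  adjᴳ (inj₁ a) (inj₁ b) = vertex-adj (lookup K a) (lookup K b) a b
  adjᴳ (inj₁ a) (inj₂ c) = label-adj a c
  adjᴳ (inj₂ c) (inj₁ a) = label-adj a c
  adjᴳ (inj₂ _) (inj₂ _) = false

  adjᴳ-sym : ∀ x y → adjᴳ x y ≡ adjᴳ y x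
  adjᴳ-sym (inj₁ a) (inj₁ b) with lookup K a | lookup K b
  ... | true | true = cong not (==-sym a b)
  ... | false | false = cong not (==-sym a b)
  ... | true | false = refl
  ... | false | true = refl
  adjᴳ-sym (inj₁ a) (inj₂ c) = refl
  adjᴳ-sym (inj₂ c) (inj₁ a) = refl
  adjᴳ-sym (inj₂ _) (inj₂ _) = refl

  adjᴳ-irrefl : ∀ x → adjᴳ x x ≡ false
  adjᴳ-irrefl (inj₁ a) with lookup K a
  ... | true = cong not (==-refl a)
  ... | false = cong not (==-refl a)
  adjᴳ-irrefl (inj₂ c) = refl

  G : Graph
  G = record
    { n = N + M
    ; adj = λ i j → adjᴳ (splitAt N i) (splitAt N j)
    ; sym = λ i j → adjᴳ-sym (splitAt N i) (splitAt N j)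
    ; irrefl = λ i → adjᴳ-irrefl (splitAt N i)
    }

  L : Fin N → Fin (N + M)
  L a = a ↑ˡ M

  R : Fin M → Fin (N + M)
  R c = N ↑ʳ c

  L-injective : ∀ {a b} → L a ≡ L b → a ≡ b
  L-injective {a} {b} = ↑ˡ-injective M a b

  L≢R : ∀ a c → L a ≢ R c
  L≢R a c eq with trans (sym (splitAt-↑ˡ N a M)) (trans (cong (splitAt N) eq) (splitAt-↑ʳ N M c))
  ... | ()

  L-or-R : ∀ i → (∃[ a ] i ≡ L a) ⊎ (∃[ c ] i ≡ R c)
  L-or-R i with splitAt N i in eq
  ... | inj₁ a = inj₁ (a , trans (sym (join-splitAt N M i)) (cong (join N M) eq))
  ... | inj₂ c = inj₂ (c , trans (sym (join-splitAt N M i)) (cong (join N M) eq))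

  G-LL : ∀ a b → adj G (L a) (L b) ≡ vertex-adj (lookup K a) (lookup K b) a b
  G-LL a b rewrite splitAt-↑ˡ N a M | splitAt-↑ˡ N b M = refl

  G-LR : ∀ a c → adj G (L a) (R c) ≡ label-adj a c
  G-LR a c rewrite splitAt-↑ˡ N a M | splitAt-↑ʳ N M c = refl

  G-RL : ∀ c a → adj G (R c) (L a) ≡ label-adj a c
  G-RL c a rewrite splitAt-↑ˡ N a M | splitAt-↑ʳ N M c = refl

  G-RR : ∀ c d → adj G (R c) (R d) ≡ false
  G-RR c d rewrite splitAt-↑ʳ N M c | splitAt-↑ʳ N M d = refl

  vertex-part : Bool → Fin N → Fin N → Bool
  vertex-part true t a = a == t
  vertex-part false t a = (a == t) ∨ (a == parent t)

  label-part : Bool → Fin N → Fin M → Bool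
  label-part true t c = true
  label-part false t c = not (c == label t)

  member : Fin N → Fin N ⊎ Fin M → Bool
  member t (inj₁ a) = vertex-part (lookup K t) t a
  member t (inj₂ c) = label-part (lookup K t) t c

  φ : Fin N → Subset (N + M)
  φ t = tabulate (member t ∘ splitAt N)

  φ-L : ∀ t a → lookup (φ t) (L a) ≡ vertex-part (lookup K t) t a
  φ-L t a = trans (lookup∘tabulate _ (L a)) (cong (member t) (splitAt-↑ˡ N a M))

  φ-R : ∀ t c → lookup (φ t) (R c) ≡ label-part (lookup K t) t c
  φ-R t c = trans (lookup∘tabulate _ (R c)) (cong (member t) (splitAt-↑ʳ N M c))

  t∈φt : ∀ t → lookup (φ t) (L t) ≡ true
  t∈φt t rewrite φ-L t t with lookup K t
  ... | true = ==-refl t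
  ... | false rewrite ==-refl t = refl

  parent∈φ : ∀ {t} → lookup K t ≡ false → lookup (φ t) (L (parent t)) ≡ true
  parent∈φ {t} t∉K rewrite φ-L t (parent t) | t∉K | ==-refl (parent t) = ∨-zeroʳ _

  L∉φK : ∀ {t a} → lookup K t ≡ true → a ≢ t → lookup (φ t) (L a) ≡ false
  L∉φK {t} {a} t∈K a≢t rewrite φ-L t a | t∈K = ==-≢ a≢t

  L∉φS : ∀ {t a} → lookup K t ≡ false → a ≢ t → a ≢ parent t → lookup (φ t) (L a) ≡ false
  L∉φS {t} {a} t∉K a≢t a≢p rewrite φ-L t a | t∉K | ==-≢ a≢t | ==-≢ a≢p = refl

  R∈φK : ∀ {t} c → lookup K t ≡ true → lookup (φ t) (R c) ≡ true
  R∈φK {t} c t∈K rewrite φ-R t c | t∈K = refl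

  R∈φS : ∀ {t c} → lookup K t ≡ false → c ≢ label t → lookup (φ t) (R c) ≡ true
  R∈φS {t} {c} t∉K c≢ rewrite φ-R t c | t∉K | ==-≢ c≢ = refl

  label∉φ : ∀ {t} → lookup K t ≡ false → lookup (φ t) (R (label t)) ≡ false
  label∉φ {t} t∉K rewrite φ-R t (label t) | t∉K | ==-refl (label t) = refl

  vertex-part-cases : ∀ t a → vertex-part (lookup K t) t a ≡ true → a ≡ t ⊎ (lookup K t ≡ false × a ≡ parent t)
  vertex-part-cases t a a∈ with lookup K t in t∈K
  ... | true = inj₁ (==⇒≡ a∈)
  ... | false with ∨-==-cases (_== t) a∈
  ... | inj₁ a≡t = inj₁ (==⇒≡ a≡t)
  ... | inj₂ a≡p = inj₂ (refl , a≡p)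

  φ-count : ∀ t → count (lookup (φ t)) ≡ suc M
  φ-count t = trans (count-splitAt N (lookup (φ t)))
    (trans (cong₂ _+_ (count-cong (φ-L t)) (count-cong (φ-R t))) (by-kind (lookup K t) refl))
    where
    by-kind : ∀ b → lookup K t ≡ b → count (vertex-part b t) + count (label-part b t) ≡ suc M
    by-kind true _ = cong₂ _+_ (count-singleton t) (count-true M)
    by-kind false t∉K = cong₂ _+_ (count-pair (parent≢ t∉K ∘ sym))
      (ℕ.suc-injective (trans (sym (count-remove (λ _ → true) {label t} refl)) (count-true M)))

  child-parent-nonadjacent : ∀ {t} → lookup K t ≡ false → adjᴳ (inj₁ t) (inj₁ (parent t)) ≡ false
  child-parent-nonadjacent {t} t∉K rewrite t∉K | parent∈K t∉K = cong not (==-refl (parent t))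

  module _ (t : Fin N) where

    vertex-pair : ∀ {a b} → vertex-part (lookup K t) t a ≡ true → vertex-part (lookup K t) t b ≡ true →
      adj G (L a) (L b) ≡ false
    vertex-pair {a} {b} a∈ b∈ rewrite G-LL a b with vertex-part-cases t a a∈ | vertex-part-cases t b b∈
    ... | inj₁ refl | inj₁ refl = adjᴳ-irrefl (inj₁ a)
    ... | inj₂ (_ , refl) | inj₂ (_ , refl) = adjᴳ-irrefl (inj₁ a)
    ... | inj₁ refl | inj₂ (t∉K , refl) = child-parent-nonadjacent t∉K
    ... | inj₂ (t∉K , refl) | inj₁ refl = trans (adjᴳ-sym (inj₁ (parent t)) (inj₁ t)) (child-parent-nonadjacent t∉K)

    vertex-label : ∀ {a c} → vertex-part (lookup K t) t a ≡ true → label-part (lookup K t) t c ≡ true →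
      adj G (L a) (R c) ≡ false
    vertex-label {a} {c} a∈ c∈ rewrite G-LR a c with vertex-part-cases t a a∈
    ... | inj₂ (t∉K , refl) rewrite parent∈K t∉K = refl
    ... | inj₁ refl with lookup K t
    ... | true = refl
    ... | false rewrite not-injective {y = false} c∈ = refl

  φ-independent : ∀ t → Independentᵇ G (φ t)
  φ-independent t i j i∈ j∈ with L-or-R i | L-or-R j
  ... | inj₁ (a , refl) | inj₁ (b , refl) = vertex-pair t (trans (sym (φ-L t a)) i∈) (trans (sym (φ-L t b)) j∈)
  ... | inj₁ (a , refl) | inj₂ (c , refl) = vertex-label t (trans (sym (φ-L t a)) i∈) (trans (sym (φ-R t c)) j∈)
  ... | inj₂ (c , refl) | inj₁ (a , refl) =
    trans (adj-sym G (R c) (L a)) (vertex-label t (trans (sym (φ-L t a)) j∈) (trans (sym (φ-R t c)) i∈))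
  ... | inj₂ (c , refl) | inj₂ (d , refl) = G-RR c d

  φ-injective : ∀ x y → φ x ≡ φ y → x ≡ y
  φ-injective x y φx≡φy
    with vertex-part-cases y x (trans (sym (φ-L y x)) (subst (λ X → lookup X (L x) ≡ true) φx≡φy (t∈φt x)))
       | vertex-part-cases x y (trans (sym (φ-L x y)) (subst (λ X → lookup X (L y) ≡ true) (sym φx≡φy) (t∈φt y)))
  ... | inj₁ x≡y | _ = x≡y
  ... | _ | inj₁ y≡x = sym y≡x
  ... | inj₂ (y∉K , x≡py) | inj₂ (x∉K , _) = ⊥-elim (∈∉⇒≢ {p = K} (parent∈K y∉K) x∉K (sym x≡py))

  exchange-KK : ∀ {x y} → lookup K x ≡ true → lookup K y ≡ true → x ≢ y → Exchange (φ x) (φ y) (L x) (L y)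
  exchange-KK {x} {y} x∈K y∈K x≢y =
    exchange-pointwise (t∈φt x) (L∉φK y∈K x≢y) (t∈φt y) (L∉φK x∈K (x≢y ∘ sym)) agree
    where
    agree : ∀ i → i ≢ L x → i ≢ L y → lookup (φ x) i ≡ lookup (φ y) i
    agree i i≢x i≢y with L-or-R i
    ... | inj₁ (a , refl) = trans (L∉φK x∈K (i≢x ∘ cong L)) (sym (L∉φK y∈K (i≢y ∘ cong L)))
    ... | inj₂ (c , refl) = trans (R∈φK c x∈K) (sym (R∈φK c y∈K))

  exchange-KS : ∀ {x y} → lookup K x ≡ true → lookup K y ≡ false → parent y ≡ x →
    Exchange (φ x) (φ y) (R (label y)) (L y)
  exchange-KS {x} {y} x∈K y∉K py≡x =
    exchange-pointwise (R∈φK (label y) x∈K) (label∉φ y∉K) (t∈φt y) (L∉φK x∈K y≢x) agree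
    where
    y≢x : y ≢ x
    y≢x y≡x = ∈∉⇒≢ {p = K} x∈K y∉K (sym y≡x)
    agree : ∀ i → i ≢ R (label y) → i ≢ L y → lookup (φ x) i ≡ lookup (φ y) i
    agree i i≢label i≢y with L-or-R i
    ... | inj₂ (c , refl) = trans (R∈φK c x∈K) (sym (R∈φS y∉K (i≢label ∘ cong R)))
    ... | inj₁ (a , refl) with a ≟ x
    ... | yes refl = trans (t∈φt a) (sym (subst (λ p → lookup (φ y) (L p) ≡ true) py≡x (parent∈φ y∉K)))
    ... | no a≢x = trans (L∉φK x∈K a≢x) (sym (L∉φS y∉K (i≢y ∘ cong L) (a≢x ∘ flip trans py≡x)))

  own-label : ∀ {w} → lookup K w ≡ false → Edge G (R (label w)) (L w)
  own-label {w} w∉K rewrite G-RL (label w) w | w∉K = ==-refl (label w)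

  φ-edge : ∀ x y → Edge F x y → TSAdj G (φ x) (φ y)
  φ-edge x y xy with lookup K x in x∈K | lookup K y in y∈K
  ... | true | true = exchange⇒TSAdj G (exchange-KK x∈K y∈K (edge⇒≢ F xy)) Lx-Ly
    where
    Lx-Ly : Edge G (L x) (L y)
    Lx-Ly rewrite G-LL x y | x∈K | y∈K | ==-≢ (edge⇒≢ F xy) = refl
  ... | true | false =
    exchange⇒TSAdj G (exchange-KS x∈K y∈K (sym (parent-unique y∈K (edge-sym F xy)))) (own-label y∈K)
  ... | false | true = exchange⇒TSAdj G (exchange-sym (exchange-KS y∈K x∈K (sym (parent-unique x∈K xy))))
                                        (edge-sym G (own-label x∈K))
  ... | false | false = ⊥-elim (adj-false⇒¬Edge F (S-nonadjacent x∈K y∈K) xy)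

  -- Unless parent y = x, both L y and L (parent y) leave φ y, but an exchange removes only one element.
  KS-edge : ∀ {x y p s} → lookup K x ≡ true → lookup K y ≡ false → Exchange (φ y) (φ x) p s → Edge F y x
  KS-edge {x} {y} x∈K y∉K ex with parent y ≟ x
  ... | yes py≡x = subst (Edge F y) py≡x (parent-edge y∉K)
  ... | no py≢x = ⊥-elim (parent≢ y∉K (sym (L-injective
          (exchange-removed-unique ex (t∈φt y) (L∉φK x∈K y≢x) (parent∈φ y∉K) (L∉φK x∈K py≢x)))))
    where
    y≢x : y ≢ x
    y≢x y≡x = ∈∉⇒≢ {p = K} x∈K y∉K (sym y≡x)

  ¬SS-exchange : ∀ {x y p s} → lookup K x ≡ false → lookup K y ≡ false → x ≢ y → ¬ Exchange (φ x) (φ y) p s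
  ¬SS-exchange {x} {y} x∉K y∉K x≢y ex = second-leaver (parent x ≟ parent y)
    where
    x∉φy : lookup (φ y) (L x) ≡ false
    x∉φy = L∉φS y∉K x≢y (λ x≡py → ∈∉⇒≢ {p = K} (parent∈K y∉K) x∉K (sym x≡py))
    second-leaver : Dec (parent x ≡ parent y) → ⊥
    second-leaver (no px≢py) = parent≢ x∉K (sym (L-injective (exchange-removed-unique ex (t∈φt x) x∉φy
      (parent∈φ x∉K) (L∉φS y∉K (λ px≡y → ∈∉⇒≢ {p = K} (parent∈K x∉K) y∉K px≡y) px≢py))))
    second-leaver (yes px≡py) = L≢R x (label y) (exchange-removed-unique ex (t∈φt x) x∉φy
      (R∈φS x∉K (x≢y ∘ sym ∘ label-injective y∉K x∉K (sym px≡py))) (label∉φ y∉K))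

  φ-edge⁻¹ : ∀ x y → TSAdj G (φ x) (φ y) → Edge F x y
  φ-edge⁻¹ x y adj-xy with TSAdj⇒exchange G adj-xy
  ... | _ , _ , ex , _ with x ≟ y
  ... | yes refl = ⊥-elim (∈∉⇒≢ {p = φ x} (Exchange.u∈I ex) (Exchange.u∉J ex) refl)
  ... | no x≢y with lookup K x in x∈K | lookup K y in y∈K
  ... | true | true = K-edge x∈K y∈K x≢y
  ... | true | false = edge-sym F (KS-edge x∈K y∈K (exchange-sym ex))
  ... | false | true = KS-edge y∈K x∈K ex
  ... | false | false = ⊥-elim (¬SS-exchange x∈K y∈K x≢y ex)

  module Surjectivity (J : Subset (N + M)) (J-independent : Independentᵇ G J) (J-count : count (lookup J) ≡ suc M) where

    φ≡J : ∀ {t} → lookup J ⊆ᵇ lookup (φ t) → φ t ≡ J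
    φ≡J {t} J⊆φ = lookup-ext pointwise
      where
      φ⊆J : lookup (φ t) ⊆ᵇ lookup J
      φ⊆J = count-⊆-antisym J⊆φ (≤-reflexive (trans (φ-count t) (sym J-count)))
      pointwise : ∀ i → lookup (φ t) i ≡ lookup J i
      pointwise i with lookup J i in i∈J | lookup (φ t) i in i∈φ
      ... | true | true = refl
      ... | false | false = refl
      ... | true | false = trans (sym i∈φ) (J⊆φ i i∈J)
      ... | false | true = trans (sym (φ⊆J i i∈φ)) i∈J

    ¬⊆-small : ∀ {h} → lookup J ⊆ᵇ h → count h ≤ M → ⊥
    ¬⊆-small J⊆h small = <⇒≱ ≤-refl (subst (_≤ M) J-count (≤-trans (count-mono J⊆h) small))

    same-kind-unique : ∀ {a b} → lookup J (L a) ≡ true → lookup J (L b) ≡ true → lookup K a ≡ lookup K b → a ≡ b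
    same-kind-unique {a} {b} a∈J b∈J same with a ≟ b
    ... | yes a≡b = a≡b
    ... | no a≢b = ⊥-elim (adj-false⇒¬Edge G (J-independent (L a) (L b) a∈J b∈J) La-Lb)
      where
      La-Lb : Edge G (L a) (L b)
      La-Lb rewrite G-LL a b | same with lookup K b
      ... | true = cong not (==-≢ a≢b)
      ... | false = cong not (==-≢ a≢b)

    label∈φ : ∀ {w c} → lookup J (L w) ≡ true → lookup K w ≡ false → lookup J (R c) ≡ true →
      lookup (φ w) (R c) ≡ true
    label∈φ {w} {c} w∈J w∉K c∈J = R∈φS w∉K λ c≡label →
      adj-false⇒¬Edge G (J-independent (L w) (R c) w∈J c∈J)
        (subst (λ d → Edge G (L w) (R d)) (sym c≡label) (edge-sym G (own-label w∉K)))

    KS-preimage : ∀ {v w} → lookup J (L v) ≡ true → lookup K v ≡ true →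
      lookup J (L w) ≡ true → lookup K w ≡ false → φ w ≡ J
    KS-preimage {v} {w} v∈J v∈K w∈J w∉K = φ≡J J⊆φw
      where
      pw≡v : parent w ≡ v
      pw≡v with parent w ≟ v
      ... | yes pw≡v = pw≡v
      ... | no pw≢v = ⊥-elim (adj-false⇒¬Edge G (J-independent (L v) (L w) v∈J w∈J) Lv-Lw)
        where
        Lv-Lw : Edge G (L v) (L w)
        Lv-Lw rewrite G-LL v w | v∈K | w∉K | ==-≢ pw≢v = refl
      J⊆φw : lookup J ⊆ᵇ lookup (φ w)
      J⊆φw i i∈J with L-or-R i
      ... | inj₂ (c , refl) = label∈φ w∈J w∉K i∈J
      ... | inj₁ (a , refl) with lookup K a in a∈K
      ... | true = subst (λ b → lookup (φ w) (L b) ≡ true)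
                         (trans pw≡v (same-kind-unique v∈J i∈J (trans v∈K (sym a∈K)))) (parent∈φ w∉K)
      ... | false = subst (λ b → lookup (φ w) (L b) ≡ true) (same-kind-unique w∈J i∈J (trans w∉K (sym a∈K))) (t∈φt w)

    K-preimage : ∀ {v} → lookup J (L v) ≡ true → lookup K v ≡ true →
      (∀ a → lookup J (L a) ≡ true → lookup K a ≡ true) → φ v ≡ J
    K-preimage {v} v∈J v∈K only-K = φ≡J J⊆φv
      where
      J⊆φv : lookup J ⊆ᵇ lookup (φ v)
      J⊆φv i i∈J with L-or-R i
      ... | inj₂ (c , refl) = R∈φK c v∈K
      ... | inj₁ (a , refl) =
        subst (λ b → lookup (φ v) (L b) ≡ true) (same-kind-unique v∈J i∈J (trans v∈K (sym (only-K a i∈J)))) (t∈φt v)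

    -- Without a K-vertex, J has at most one vertex of F and then misses its label: |J| ≤ M.
    S-only⇒⊥ : ∀ {w} → lookup J (L w) ≡ true → (∀ a → lookup J (L a) ≡ true → lookup K a ≡ false) → ⊥
    S-only⇒⊥ {w} w∈J only-S = ¬⊆-small J⊆φw-p
      (≤-reflexive (ℕ.suc-injective (trans (sym (count-remove (lookup (φ w)) (parent∈φ w∉K))) (φ-count w))))
      where
      w∉K : lookup K w ≡ false
      w∉K = only-S w w∈J
      J⊆φw-p : lookup J ⊆ᵇ (λ i → lookup (φ w) i ∧ not (i == L (parent w)))
      J⊆φw-p i i∈J with L-or-R i
      ... | inj₂ (c , refl) = cong₂ (λ b e → b ∧ not e) (label∈φ w∈J w∉K i∈J) (==-≢ (L≢R (parent w) c ∘ sym))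
      ... | inj₁ (a , refl) with same-kind-unique w∈J i∈J (trans w∉K (sym (only-S a i∈J)))
      ... | refl = cong₂ (λ b e → b ∧ not e) (t∈φt w) (==-≢ (parent≢ w∉K ∘ sym ∘ L-injective))

    labels-only⇒⊥ : (∀ a → lookup J (L a) ≡ false) → ⊥
    labels-only⇒⊥ no-vertex = ¬⊆-small J⊆labels (≤-reflexive count-labels)
      where
      is-label : Fin N ⊎ Fin M → Bool
      is-label (inj₁ _) = false
      is-label (inj₂ _) = true
      count-labels : count (is-label ∘ splitAt N) ≡ M
      count-labels = trans (count-splitAt N (is-label ∘ splitAt N)) (cong₂ _+_
        (trans (count-cong (λ a → cong is-label (splitAt-↑ˡ N a M))) (count-false {N} (λ _ → false) (λ _ → refl)))
        (trans (count-cong (λ c → cong is-label (splitAt-↑ʳ N M c))) (count-true M)))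
      J⊆labels : lookup J ⊆ᵇ (is-label ∘ splitAt N)
      J⊆labels i i∈J with L-or-R i
      ... | inj₂ (c , refl) rewrite splitAt-↑ʳ N M c = refl
      ... | inj₁ (a , refl) = ⊥-elim (∈∉⇒≢ {p = J} i∈J (no-vertex a) refl)

    preimage : ∃ λ x → φ x ≡ J
    preimage with any? (λ v → (lookup J (L v) ≟ᵇ true) ×-dec (lookup K v ≟ᵇ true))
                | any? (λ w → (lookup J (L w) ≟ᵇ true) ×-dec (lookup K w ≟ᵇ false))
    ... | yes (v , v∈J , v∈K) | yes (w , w∈J , w∉K) = w , KS-preimage v∈J v∈K w∈J w∉K
    ... | yes (v , v∈J , v∈K) | no no-S = v , K-preimage v∈J v∈K λ a a∈J → ¬-not λ a∉K → no-S (a , a∈J , a∉K)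
    ... | no no-K | _ with any? (λ w → lookup J (L w) ≟ᵇ true)
    ... | yes (w , w∈J) = ⊥-elim (S-only⇒⊥ w∈J λ a a∈J → ¬-not λ a∈K → no-K (a , a∈J , a∈K))
    ... | no no-vertex = ⊥-elim (labels-only⇒⊥ λ a → ¬-not (no-vertex ∘ (a ,_)))

  φ-iso : IsoToTS (suc M) F G
  φ-iso = φ , (λ x → toIsIndependent G (φ-independent x) , trans (∣∣≡count (φ x)) (φ-count x))
            , φ-injective
            , (λ J J-vertex → Surjectivity.preimage J (fromIsIndependent G (proj₁ J-vertex))
                                                      (trans (sym (∣∣≡count J)) (proj₂ J-vertex)))
            , φ-edge , φ-edge⁻¹

sufficiency : ∀ k → 2 ≤ k → (F : Graph) (K : Subset (n F)) → IsKSPartition F K →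
  (∀ v → v ∈ K → ∣ Nbhd F v ∩ ∁ K ∣ ≤ k ∸ 1) × (∀ w → w ∈ ∁ K → ∣ Nbhd F w ∣ ≡ 1) →
  IsTSReconfigurationGraph k F
sufficiency (suc (suc m)) (s≤s (s≤s z≤n)) F K ks (bound , degree) = G , φ-iso
  where open Sufficiency m F K ks bound degree

proposition5 : (k : ℕ) → 2 ≤ k → (F : Graph) → Connected F →
    (K : Subset (n F)) → IsKMaxKSPartition F K →
    (IsTSReconfigurationGraph k F ⇔
      ((∀ v → v ∈ K → ∣ Nbhd F v ∩ ∁ K ∣ ≤ k ∸ 1) ×
       (∀ w → w ∈ ∁ K → ∣ Nbhd F w ∣ ≡ 1)))
proposition5 k 2≤k F connected K kmax = mk⇔
  (λ (G , iso) → Necessity.necessity k 2≤k F connected K kmax G iso)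
  (sufficiency k 2≤k F K (proj₁ kmax))
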